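{- Let $P_n$ be the path with vertices $v_1,\dots,v_n$ and edges $v_iv_{i+1}$ ($1\le i\le n-1$), let $L_{P_n}$ be its Laplacian matrix, and let $B_{P_n}=(L_{P_n}+I_n)^{ -1}=[b_{ij}]$. Then $B_{P_n}$ is $d$-monotone, i.e. \[ b_{i1}<b_{i2}<\cdots<b_{i,i-1}<b_{ii}>b_{i,i+1}>\cdots>b_{in}\qquad(1\le i\le n). \] In fact the following stronger property holds: \[ b_{ij}\ge 2\,b_{i,j+1}\quad(1\le i\le j\le n-1),\qquad b_{ij}\ge 2\,b_{i,j-1}\quad (2\le j\le i\le n). \]
   Context: The Laplacian matrix of a simple graph $G$ is $L_G=D-A$, where $A$ is the adjacency matrix and $D$ is the diagonal matrix of vertex degrees; row/column $i$ corresponds to vertex $v_i$. The matrix $L_G+I_n$ is positive definite, hence invertible. -}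

module Defs where

open import Data.Nat using (ℕ; zero; suc)
open import Data.Fin using (Fin; zero; suc; toℕ)
open import Data.Rational using (ℚ; 0ℚ; 1ℚ; _+_; _-_; _*_)
open import Relation.Nullary using (Dec; yes; no)
open import Relation.Nullary.Decidable using (⌊_⌋)
open import Data.Fin using (_≟_)
open import Data.Bool using (Bool; true; false; if_then_else_; _∨_)
import Data.Nat as ℕ
open import Data.Product using (_×_)
open import Relation.Binary.PropositionalEquality using (_≡_)

-- Square rational matrices, rows/columns indexed by Fin n
-- (index k : Fin n corresponds to vertex v_{k+1}).
Matrix : ℕ → Set
Matrix n = Fin n → Fin n → ℚ

∑ : ∀ {n} → (Fin n → ℚ) → ℚ
∑ {zero}  f = 0ℚ
∑ {suc n} f = f zero + ∑ (λ k → f (suc k))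

_⊗_ : ∀ {n} → Matrix n → Matrix n → Matrix n
(M ⊗ N) i j = ∑ (λ k → M i k * N k j)

I : ∀ {n} → Matrix n
I i j = if ⌊ i ≟ j ⌋ then 1ℚ else 0ℚ

_+ᴹ_ : ∀ {n} → Matrix n → Matrix n → Matrix n
(M +ᴹ N) i j = M i j + N i j

pathAdj? : ∀ {n} → Fin n → Fin n → Bool
pathAdj? i j = ⌊ toℕ j ℕ.≟ suc (toℕ i) ⌋ ∨ ⌊ toℕ i ℕ.≟ suc (toℕ j) ⌋

pathA : ∀ n → Matrix n
pathA n i j = if pathAdj? i j then 1ℚ else 0ℚ

pathD : ∀ n → Matrix n
pathD n i j = if ⌊ i ≟ j ⌋ then ∑ (λ k → pathA n i k) else 0ℚ

pathL : ∀ n → Matrix n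
pathL n i j = pathD n i j - pathA n i j

IsInverseOf : ∀ {n} → Matrix n → Matrix n → Set
IsInverseOf B M = (∀ i j → (M ⊗ B) i j ≡ I i j) × (∀ i j → (B ⊗ M) i j ≡ I i j)

{-# OPTIONS --safe #-}
-- Row i of B solves x (L + I) = e_i. Extending the row by ghost values
-- x₋₁ := x₀ and x_n := x_{n-1} turns each of these equations into the recurrence
-- x_{q-1} + x_{q+1} = 3 x_q for q ≠ i, and x_{i-1} + x_{i+1} + 1 = 3 x_i.
-- Read from an end towards i, a solution of the recurrence whose first value is
-- nonnegative and equal to its ghost is nondecreasing, and then every step at least
-- doubles it. Both end values are positive: otherwise the value at i would be
-- nonpositive, but it is positive if either end is, and at least 1 if it is a local
-- minimum. Hence the row at least doubles at every step towards i, from either side.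
module Submission where

open import Defs
open import Data.Nat using (ℕ; suc)
open import Data.Fin using (Fin; toℕ)
open import Data.Rational using (ℚ; 1ℚ; _+_; _*_; _<_; _≤_)
open import Data.Product using (_×_)
open import Relation.Binary.PropositionalEquality using (_≡_)
import Data.Nat as ℕ

open import Data.Nat using (zero; _∸_)
open import Data.Fin using (zero; suc; inject₁; fromℕ<; _≟_)
open import Data.Rational using (0ℚ; -_; _-_)
import Data.Nat.Properties as ℕₚ
import Data.Fin.Properties as Finₚ
import Data.Rational.Properties as ℚₚ
open import Data.Bool using (Bool; if_then_else_; _∨_)
open import Data.Bool.Properties using (∨-comm)
open import Data.Product using (_,_; proj₁; proj₂)
open import Function using (_∘_)
open import Relation.Binary.PropositionalEquality
  using (_≢_; refl; sym; trans; cong; cong₂; subst; subst₂; module ≡-Reasoning)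
open import Relation.Nullary using (yes; no)
open import Relation.Nullary.Decidable
  using (⌊_⌋; isYes≗does; ⌊⌋-map′; dec-true; dec-false)
open import Data.Rational.Solver using (module +-*-Solver)
open +-*-Solver

2ℚ 3ℚ : ℚ
2ℚ = 1ℚ + 1ℚ
3ℚ = 2ℚ + 1ℚ

∑-cong : ∀ {n} {f g : Fin n → ℚ} → (∀ k → f k ≡ g k) → ∑ f ≡ ∑ g
∑-cong {zero}  f≗g = refl
∑-cong {suc n} f≗g = cong₂ _+_ (f≗g zero) (∑-cong (f≗g ∘ suc))

∑-0 : ∀ {n} {f : Fin n → ℚ} → (∀ k → f k ≡ 0ℚ) → ∑ f ≡ 0ℚ
∑-0 {zero}  f≗0 = refl
∑-0 {suc n} f≗0 = cong₂ _+_ (f≗0 zero) (∑-0 (f≗0 ∘ suc))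

∑-distrib-+ : ∀ {n} (f g : Fin n → ℚ) → ∑ (λ k → f k + g k) ≡ ∑ f + ∑ g
∑-distrib-+ {zero}  f g = refl
∑-distrib-+ {suc n} f g = trans (cong ((f zero + g zero) +_) (∑-distrib-+ (f ∘ suc) (g ∘ suc)))
  (solve 4 (λ a b c d → (a :+ b) :+ (c :+ d) := (a :+ c) :+ (b :+ d)) refl
    (f zero) (g zero) (∑ (f ∘ suc)) (∑ (g ∘ suc)))

∑-distrib-diff : ∀ {n} (f g : Fin n → ℚ) → ∑ (λ k → f k - g k) ≡ ∑ f - ∑ g
∑-distrib-diff {zero}  f g = refl
∑-distrib-diff {suc n} f g = trans (cong ((f zero - g zero) +_) (∑-distrib-diff (f ∘ suc) (g ∘ suc)))
  (solve 4 (λ a b c d → (a :- b) :+ (c :- d) := (a :+ c) :- (b :+ d)) refl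
    (f zero) (g zero) (∑ (f ∘ suc)) (∑ (g ∘ suc)))

∑-pick : ∀ {n} (x c : Fin n → ℚ) (j : Fin n) →
         ∑ (λ k → x k * (if ⌊ k ≟ j ⌋ then c k else 0ℚ)) ≡ x j * c j
∑-pick x c zero = begin
  x zero * c zero + ∑ (λ k → x (suc k) * 0ℚ)
    ≡⟨ cong (x zero * c zero +_) (∑-0 (ℚₚ.*-zeroʳ ∘ x ∘ suc)) ⟩
  x zero * c zero + 0ℚ
    ≡⟨ ℚₚ.+-identityʳ _ ⟩
  x zero * c zero ∎
  where open ≡-Reasoning
∑-pick x c (suc j) = begin
  x zero * 0ℚ + ∑ (λ k → x (suc k) * (if ⌊ suc k ≟ suc j ⌋ then c (suc k) else 0ℚ))
    ≡⟨ cong₂ _+_ (ℚₚ.*-zeroʳ (x zero)) (∑-cong (λ k → cong (pick k) (⌊⌋-map′ _ _ (k ≟ j)))) ⟩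
  0ℚ + ∑ (λ k → pick k ⌊ k ≟ j ⌋)
    ≡⟨ ℚₚ.+-identityˡ _ ⟩
  ∑ (λ k → pick k ⌊ k ≟ j ⌋)
    ≡⟨ ∑-pick (x ∘ suc) (c ∘ suc) j ⟩
  x (suc j) * c (suc j) ∎
  where
  open ≡-Reasoning
  pick : Fin _ → Bool → ℚ
  pick k b = x (suc k) * (if b then c (suc k) else 0ℚ)

adjacent? : ∀ {n} → Fin n → Fin n → Bool
adjacent? i j = (toℕ j ℕ.≡ᵇ suc (toℕ i)) ∨ (toℕ i ℕ.≡ᵇ suc (toℕ j))

pathAdj?≡adjacent? : ∀ {n} (i j : Fin n) → pathAdj? i j ≡ adjacent? i j
pathAdj?≡adjacent? i j =
  cong₂ _∨_ (isYes≗does (toℕ j ℕ.≟ suc (toℕ i))) (isYes≗does (toℕ i ℕ.≟ suc (toℕ j)))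

pathA-sym : ∀ n (i j : Fin n) → pathA n i j ≡ pathA n j i
pathA-sym n i j = cong (λ b → if b then 1ℚ else 0ℚ) (begin
  pathAdj? i j  ≡⟨ pathAdj?≡adjacent? i j ⟩
  adjacent? i j ≡⟨ ∨-comm (toℕ j ℕ.≡ᵇ suc (toℕ i)) _ ⟩
  adjacent? j i ≡⟨ sym (pathAdj?≡adjacent? j i) ⟩
  pathAdj? j i  ∎)
  where open ≡-Reasoning

pathA-suc : ∀ n (i j : Fin n) → pathA (suc n) (suc i) (suc j) ≡ pathA n i j
pathA-suc n i j = cong (λ b → if b then 1ℚ else 0ℚ)
  (trans (pathAdj?≡adjacent? (suc i) (suc j)) (sym (pathAdj?≡adjacent? i j)))

before : ∀ {n} → (Fin n → ℚ) → Fin n → ℚ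
before x zero    = 0ℚ
before x (suc j) = x (inject₁ j)

after : ∀ {n} → (Fin n → ℚ) → Fin n → ℚ
after {suc zero}    x zero    = 0ℚ
after {suc (suc n)} x zero    = x (suc zero)
after               x (suc j) = after (x ∘ suc) j

before-suc : ∀ {n} (x : Fin (suc n) → ℚ) (j : Fin n) →
             x zero * pathA (suc n) zero (suc j) + before (x ∘ suc) j ≡ before x (suc j)
before-suc x zero    = solve 1 (λ a → a :* con 1ℚ :+ con 0ℚ := a) refl (x zero)
before-suc x (suc j) = solve 2 (λ a b → a :* con 0ℚ :+ b := b) refl (x zero) (x (suc (inject₁ j)))

∑-pathA : ∀ {n} (x : Fin n → ℚ) (j : Fin n) → ∑ (λ k → x k * pathA n k j) ≡ before x j + after x j
∑-pathA {suc zero} x zero =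
  solve 1 (λ a → a :* con 0ℚ :+ con 0ℚ := con 0ℚ :+ con 0ℚ) refl (x zero)
∑-pathA {suc (suc n)} x zero = begin
  x zero * 0ℚ + (x (suc zero) * 1ℚ + ∑ (λ k → x (suc (suc k)) * 0ℚ))
    ≡⟨ cong (λ s → x zero * 0ℚ + (x (suc zero) * 1ℚ + s))
            (∑-0 (λ k → ℚₚ.*-zeroʳ (x (suc (suc k))))) ⟩
  x zero * 0ℚ + (x (suc zero) * 1ℚ + 0ℚ)
    ≡⟨ solve 2 (λ a b → a :* con 0ℚ :+ (b :* con 1ℚ :+ con 0ℚ) := con 0ℚ :+ b) refl
               (x zero) (x (suc zero)) ⟩
  0ℚ + x (suc zero) ∎
  where open ≡-Reasoning
∑-pathA {suc n} x (suc j) = begin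
  x zero * a₀ + ∑ (λ k → x (suc k) * pathA (suc n) (suc k) (suc j))
    ≡⟨ cong (x zero * a₀ +_) (∑-cong (λ k → cong (x (suc k) *_) (pathA-suc n k j))) ⟩
  x zero * a₀ + ∑ (λ k → x (suc k) * pathA n k j)
    ≡⟨ cong (x zero * a₀ +_) (∑-pathA (x ∘ suc) j) ⟩
  x zero * a₀ + (before (x ∘ suc) j + after (x ∘ suc) j)
    ≡⟨ sym (ℚₚ.+-assoc (x zero * a₀) _ _) ⟩
  (x zero * a₀ + before (x ∘ suc) j) + after (x ∘ suc) j
    ≡⟨ cong (_+ after (x ∘ suc) j) (before-suc x j) ⟩
  before x (suc j) + after x (suc j) ∎
  where
  open ≡-Reasoning
  a₀ = pathA (suc n) zero (suc j)

pathA-degree : ∀ {n} (j : Fin n) → ∑ (pathA n j) ≡ before (λ _ → 1ℚ) j + after (λ _ → 1ℚ) j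
pathA-degree {n} j =
  trans (∑-cong (λ k → trans (pathA-sym n j k) (sym (ℚₚ.*-identityˡ _)))) (∑-pathA (λ _ → 1ℚ) j)

∑-column : ∀ n (x : Fin n → ℚ) (j : Fin n) →
           ∑ (λ k → x k * (pathL n +ᴹ I) k j)
             ≡ (x j * ∑ (pathA n j) - ∑ (λ k → x k * pathA n k j)) + x j * 1ℚ
∑-column n x j = begin
  ∑ (λ k → x k * ((D k j - A k j) + I k j))
    ≡⟨ ∑-cong (λ k → solve 4 (λ a d e i → a :* ((d :- e) :+ i) := (a :* d :- a :* e) :+ a :* i)
                              refl (x k) (D k j) (A k j) (I k j)) ⟩
  ∑ (λ k → (x k * D k j - x k * A k j) + x k * I k j)
    ≡⟨ ∑-distrib-+ (λ k → x k * D k j - x k * A k j) (λ k → x k * I k j) ⟩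
  ∑ (λ k → x k * D k j - x k * A k j) + ∑ (λ k → x k * I k j)
    ≡⟨ cong (_+ ∑ (λ k → x k * I k j)) (∑-distrib-diff (λ k → x k * D k j) (λ k → x k * A k j)) ⟩
  (∑ (λ k → x k * D k j) - ∑ (λ k → x k * A k j)) + ∑ (λ k → x k * I k j)
    ≡⟨ cong₂ (λ d i → (d - ∑ (λ k → x k * A k j)) + i)
             (∑-pick x (λ k → ∑ (A k)) j) (∑-pick x (λ _ → 1ℚ) j) ⟩
  (x j * ∑ (A j) - ∑ (λ k → x k * A k j)) + x j * 1ℚ ∎
  where
  open ≡-Reasoning
  A D : Matrix n
  A = pathA n
  D = pathD n

clamp : ∀ {n} → ℕ → Fin (suc n)
clamp         zero    = zero
clamp {zero}  (suc m) = zero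
clamp {suc n} (suc m) = suc (clamp m)

clamp-toℕ : ∀ {n} (j : Fin (suc n)) → clamp (toℕ j) ≡ j
clamp-toℕ         zero    = refl
clamp-toℕ {suc n} (suc j) = cong suc (clamp-toℕ j)

clamp-suc-n : ∀ n → clamp {n} (suc n) ≡ clamp n
clamp-suc-n zero    = refl
clamp-suc-n (suc n) = cong suc (clamp-suc-n n)

-- The row x with ghost vertices at both ends: padded x (suc j) = x j, while
-- padded x 0 = x 0 and padded x (suc (suc n)) = x n.
padded : ∀ {n} → (Fin (suc n) → ℚ) → ℕ → ℚ
padded x m = x (clamp (ℕ.pred m))

padded-at : ∀ {n} (x : Fin (suc n) → ℚ) (j : Fin (suc n)) → padded x (suc (toℕ j)) ≡ x j
padded-at x j = cong x (clamp-toℕ j)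

padded-before : ∀ {n} (x : Fin (suc n) → ℚ) (j : Fin (suc n)) →
                padded x (toℕ j) ≡ before x j + (1ℚ - before (λ _ → 1ℚ) j) * x j
padded-before x zero    = solve 1 (λ a → a := con 0ℚ :+ (con 1ℚ :- con 0ℚ) :* a) refl (x zero)
padded-before x (suc j) = begin
  x (clamp (toℕ j))                      ≡⟨ cong (x ∘ clamp) (sym (Finₚ.toℕ-inject₁ j)) ⟩
  padded x (suc (toℕ (inject₁ j)))       ≡⟨ padded-at x (inject₁ j) ⟩
  x (inject₁ j)                          ≡⟨ solve 2 (λ a b → a := a :+ (con 1ℚ :- con 1ℚ) :* b) refl
                                                    (x (inject₁ j)) (x (suc j)) ⟩
  x (inject₁ j) + (1ℚ - 1ℚ) * x (suc j)  ∎
  where open ≡-Reasoning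

padded-after : ∀ {n} (x : Fin (suc n) → ℚ) (j : Fin (suc n)) →
               padded x (suc (suc (toℕ j))) ≡ after x j + (1ℚ - after (λ _ → 1ℚ) j) * x j
padded-after {zero}  x zero    = solve 1 (λ a → a := con 0ℚ :+ (con 1ℚ :- con 0ℚ) :* a) refl (x zero)
padded-after {suc n} x zero    =
  solve 2 (λ a b → b := b :+ (con 1ℚ :- con 1ℚ) :* a) refl (x zero) (x (suc zero))
padded-after {suc n} x (suc j) = padded-after (λ k → x (suc k)) j

-- The ghost values exactly absorb the missing neighbours at the two ends.
padded-column : ∀ {n} (x : Fin (suc n) → ℚ) (j : Fin (suc n)) →
                padded x (toℕ j) + padded x (suc (suc (toℕ j)))
                  + ∑ (λ k → x k * (pathL (suc n) +ᴹ I) k j)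
                  ≡ 3ℚ * padded x (suc (toℕ j))
padded-column {n} x j = begin
  padded x (toℕ j) + padded x (suc (suc (toℕ j))) + ∑ (λ k → x k * (pathL (suc n) +ᴹ I) k j)
    ≡⟨ cong₂ _+_ (cong₂ _+_ (padded-before x j) (padded-after x j)) (∑-column (suc n) x j) ⟩
  (b + (1ℚ - b₁) * X) + (a + (1ℚ - a₁) * X) + ((X * degree - neighbours) + X * 1ℚ)
    ≡⟨ cong₂ (λ d s → (b + (1ℚ - b₁) * X) + (a + (1ℚ - a₁) * X) + ((X * d - s) + X * 1ℚ))
             (pathA-degree j) (∑-pathA x j) ⟩
  (b + (1ℚ - b₁) * X) + (a + (1ℚ - a₁) * X) + ((X * (b₁ + a₁) - (b + a)) + X * 1ℚ)
    ≡⟨ solve 5 (λ X b a b₁ a₁ → (b :+ (con 1ℚ :- b₁) :* X) :+ (a :+ (con 1ℚ :- a₁) :* X)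
                                  :+ ((X :* (b₁ :+ a₁) :- (b :+ a)) :+ X :* con 1ℚ)
                                := con 3ℚ :* X) refl X b a b₁ a₁ ⟩
  3ℚ * X
    ≡⟨ cong (3ℚ *_) (sym (padded-at x j)) ⟩
  3ℚ * padded x (suc (toℕ j)) ∎
  where
  open ≡-Reasoning
  X  = x j
  b  = before x j
  a  = after x j
  b₁ = before (λ _ → 1ℚ) j
  a₁ = after (λ _ → 1ℚ) j
  degree     = ∑ (pathA (suc n) j)
  neighbours = ∑ (λ k → x k * pathA (suc n) k j)

0<_≤½_ : ℚ → ℚ → Set
0< a ≤½ b = 0ℚ < a × 2ℚ * a ≤ b

<-of-≤½ : ∀ {a b} → 0< a ≤½ b → a < b
<-of-≤½ {a} {b} (0<a , 2a≤b) = begin-strict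
  a       ≡⟨ sym (ℚₚ.+-identityˡ a) ⟩
  0ℚ + a  <⟨ ℚₚ.+-monoˡ-< a 0<a ⟩
  a + a   ≡⟨ solve 1 (λ a → a :+ a := con 2ℚ :* a) refl a ⟩
  2ℚ * a  ≤⟨ 2a≤b ⟩
  b       ∎
  where open ℚₚ.≤-Reasoning

≤-2* : ∀ {b} → 0ℚ ≤ b → b ≤ 2ℚ * b
≤-2* {b} 0≤b = begin
  b       ≡⟨ sym (ℚₚ.+-identityˡ b) ⟩
  0ℚ + b  ≤⟨ ℚₚ.+-monoˡ-≤ b 0≤b ⟩
  b + b   ≡⟨ solve 1 (λ b → b :+ b := con 2ℚ :* b) refl b ⟩
  2ℚ * b  ∎
  where open ℚₚ.≤-Reasoning

neg-cancel-≤ : ∀ {a b} → - a ≤ - b → b ≤ a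
neg-cancel-≤ {a} {b} = subst₂ _≤_ (neg-involutive b) (neg-involutive a) ∘ ℚₚ.neg-antimono-≤
  where
  neg-involutive : ∀ c → - - c ≡ c
  neg-involutive = solve 1 (λ c → :- :- c := c) refl

doubling : ∀ {a b c} → a ≤ b → a + c ≡ 3ℚ * b → 2ℚ * b ≤ c
doubling {a} {b} {c} a≤b a+c≡3b = begin
  2ℚ * b       ≡⟨ solve 1 (λ b → con 2ℚ :* b := con 3ℚ :* b :- b) refl b ⟩
  3ℚ * b - b   ≡⟨ cong (_- b) (sym a+c≡3b) ⟩
  (a + c) - b  ≤⟨ ℚₚ.+-monoˡ-≤ (- b) (ℚₚ.+-monoˡ-≤ c a≤b) ⟩
  (b + c) - b  ≡⟨ solve 2 (λ b c → (b :+ c) :- b := c) refl b c ⟩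
  c            ∎
  where open ℚₚ.≤-Reasoning

1≤-of-local-minimum : ∀ {a b c} → c ≤ a → c ≤ b → a + b + 1ℚ ≡ 3ℚ * c → 1ℚ ≤ c
1≤-of-local-minimum {a} {b} {c} c≤a c≤b a+b+1≡3c = begin
  1ℚ                      ≡⟨ solve 1 (λ c → con 1ℚ := (c :+ c :+ con 1ℚ) :- (c :+ c)) refl c ⟩
  (c + c + 1ℚ) - (c + c)  ≤⟨ ℚₚ.+-monoˡ-≤ (- (c + c)) (ℚₚ.+-monoˡ-≤ 1ℚ (ℚₚ.+-mono-≤ c≤a c≤b)) ⟩
  (a + b + 1ℚ) - (c + c)  ≡⟨ cong (_- (c + c)) a+b+1≡3c ⟩
  3ℚ * c - (c + c)        ≡⟨ solve 1 (λ c → con 3ℚ :* c :- (c :+ c) := c) refl c ⟩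
  c                       ∎
  where open ℚₚ.≤-Reasoning

-- (L + I) s = 0 at the vertex with padded index 1 + q.
SolvesAt : (ℕ → ℚ) → ℕ → Set
SolvesAt s q = s q + s (suc (suc q)) ≡ 3ℚ * s (suc q)

record NeumannSolution (s : ℕ → ℚ) (K : ℕ) : Set where
  field
    boundary : s 0 ≡ s 1
    solves   : ∀ q → q ℕ.< K → SolvesAt s q

open NeumannSolution

negate : ∀ {s K} → NeumannSolution s K → NeumannSolution (λ m → - s m) K
negate     N .boundary     = cong -_ (boundary N)
negate {s} N .solves q q<K = begin
  - s q + - s (suc (suc q))  ≡⟨ sym (ℚₚ.neg-distrib-+ (s q) _) ⟩
  - (s q + s (suc (suc q)))  ≡⟨ cong -_ (solves N q q<K) ⟩
  - (3ℚ * s (suc q))         ≡⟨ solve 1 (λ b → :- (con 3ℚ :* b) := con 3ℚ :* (:- b)) refl (s (suc q)) ⟩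
  3ℚ * - s (suc q)           ∎
  where open ≡-Reasoning

-- s (2 + m) ≥ 2 s (1 + m) ≥ s (1 + m), the last step because s (1 + m) ≥ s 0 ≥ 0.
sweep : ∀ {s K} → NeumannSolution s K → 0ℚ ≤ s 0 → ∀ m → m ℕ.≤ K → s 0 ≤ s m × s m ≤ s (suc m)
sweep N 0≤s₀ zero    _   = ℚₚ.≤-refl , ℚₚ.≤-reflexive (boundary N)
sweep N 0≤s₀ (suc m) m<K =
  let s₀≤sₘ , sₘ≤sₘ₊₁ = sweep N 0≤s₀ m (ℕₚ.<⇒≤ m<K)
      s₀≤sₘ₊₁ = ℚₚ.≤-trans s₀≤sₘ sₘ≤sₘ₊₁
  in s₀≤sₘ₊₁ , ℚₚ.≤-trans (≤-2* (ℚₚ.≤-trans 0≤s₀ s₀≤sₘ₊₁)) (doubling sₘ≤sₘ₊₁ (solves N m m<K))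

positive-growth : ∀ {s K} → NeumannSolution s K → 0ℚ < s 0 →
                  ∀ m → m ℕ.< K → 0< s (suc m) ≤½ s (suc (suc m))
positive-growth N 0<s₀ m m<K =
  let s₀≤sₘ , sₘ≤sₘ₊₁ = sweep N (ℚₚ.<⇒≤ 0<s₀) m (ℕₚ.<⇒≤ m<K)
  in ℚₚ.<-≤-trans 0<s₀ (ℚₚ.≤-trans s₀≤sₘ sₘ≤sₘ₊₁) , doubling sₘ≤sₘ₊₁ (solves N m m<K)

positive-end : ∀ {s K} → NeumannSolution s K → 0ℚ < s 0 → 0ℚ < s (suc K)
positive-end {K = K} N 0<s₀ =
  let s₀≤s_K , s_K≤s_K₊₁ = sweep N (ℚₚ.<⇒≤ 0<s₀) K ℕₚ.≤-refl
  in ℚₚ.<-≤-trans 0<s₀ (ℚₚ.≤-trans s₀≤s_K s_K≤s_K₊₁)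

nonpositive-end : ∀ {s K} → NeumannSolution s K → s 0 ≤ 0ℚ → s (suc K) ≤ s K × s (suc K) ≤ s 0
nonpositive-end {K = K} N s₀≤0 =
  let -s₀≤-s_K , -s_K≤-s_K₊₁ = sweep (negate N) (ℚₚ.neg-antimono-≤ s₀≤0) K ℕₚ.≤-refl
  in neg-cancel-≤ -s_K≤-s_K₊₁ , neg-cancel-≤ (ℚₚ.≤-trans -s₀≤-s_K -s_K≤-s_K₊₁)

-- l and r are glued at a common vertex carrying a unit source. If both end values were
-- nonpositive, that vertex would be a local minimum, which the source forces to be ≥ 1.
module _ {l r : ℕ → ℚ} {Kₗ Kᵣ : ℕ} (L : NeumannSolution l Kₗ) (R : NeumannSolution r Kᵣ)
         (meet : l (suc Kₗ) ≡ r (suc Kᵣ)) (source : l Kₗ + r Kᵣ + 1ℚ ≡ 3ℚ * l (suc Kₗ)) where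

  junction-positive : 0ℚ < l (suc Kₗ)
  junction-positive with l 0 ℚₚ.≤? 0ℚ | r 0 ℚₚ.≤? 0ℚ
  ... | no l₀≰0  | _         = positive-end L (ℚₚ.≰⇒> l₀≰0)
  ... | yes _    | no r₀≰0   = subst (0ℚ <_) (sym meet) (positive-end R (ℚₚ.≰⇒> r₀≰0))
  ... | yes l₀≤0 | yes r₀≤0  = ℚₚ.<-≤-trans (ℚₚ.positive⁻¹ 1ℚ)
    (1≤-of-local-minimum (proj₁ (nonpositive-end L l₀≤0))
                         (subst (_≤ r Kᵣ) (sym meet) (proj₁ (nonpositive-end R r₀≤0)))
                         source)

  junction : 0ℚ < l 0
  junction = ℚₚ.≰⇒> λ l₀≤0 → ℚₚ.<-irrefl refl
    (ℚₚ.<-≤-trans junction-positive (ℚₚ.≤-trans (proj₂ (nonpositive-end L l₀≤0)) l₀≤0))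

-- (L + I) w = e_K on the path with vertices 0 … n, the value at vertex j being w (1 + j).
record IsGreenFunction (w : ℕ → ℚ) (n K : ℕ) : Set where
  field
    K≤n            : K ℕ.≤ n
    left-boundary  : w 0 ≡ w 1
    right-boundary : w (suc (suc n)) ≡ w (suc n)
    homogeneous    : ∀ q → q ℕ.≤ n → q ≢ K → SolvesAt w q
    source         : w K + w (suc (suc K)) + 1ℚ ≡ 3ℚ * w (suc K)

module GreenFunction {w : ℕ → ℚ} {n K : ℕ} (G : IsGreenFunction w n K) where
  open IsGreenFunction G

  reflected : ℕ → ℚ
  reflected m = w (suc (suc n) ∸ m)

  mirror : ∀ c {k} → k ℕ.≤ n → c ℕ.+ n ∸ (n ∸ k) ≡ c ℕ.+ k
  mirror c {k} k≤n = trans (ℕₚ.+-∸-assoc c (ℕₚ.m∸n≤m n k)) (cong (c ℕ.+_) (ℕₚ.m∸[m∸n]≡n k≤n))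

  left : NeumannSolution w K
  left .boundary     = left-boundary
  left .solves q q<K = homogeneous q (ℕₚ.≤-trans (ℕₚ.<⇒≤ q<K) K≤n) (ℕₚ.<⇒≢ q<K)

  right : NeumannSolution reflected (n ∸ K)
  right .boundary       = right-boundary
  right .solves q q<n∸K = begin
    w (suc (suc n) ∸ q) + w p  ≡⟨ cong (λ m → w m + w p) (ℕₚ.+-∸-assoc 2 q≤n) ⟩
    w (suc (suc p)) + w p      ≡⟨ ℚₚ.+-comm _ (w p) ⟩
    w p + w (suc (suc p))      ≡⟨ homogeneous p (ℕₚ.m∸n≤m n q) (ℕₚ.>⇒≢ K<p) ⟩
    3ℚ * w (suc p)             ≡⟨ cong (λ m → 3ℚ * w m) (sym (ℕₚ.+-∸-assoc 1 q≤n)) ⟩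
    3ℚ * w (suc n ∸ q)         ∎
    where
    open ≡-Reasoning
    p = n ∸ q
    q≤n : q ℕ.≤ n
    q≤n = ℕₚ.≤-trans (ℕₚ.<⇒≤ q<n∸K) (ℕₚ.m∸n≤m n K)
    K<p : K ℕ.< p
    K<p = ℕₚ.m+n≤o⇒m≤o∸n (suc K) (subst (ℕ._≤ n) (cong suc (ℕₚ.+-comm q K))
                                       (ℕₚ.m≤o∸n⇒m+n≤o (suc q) K≤n q<n∸K))

  meet : w (suc K) ≡ reflected (suc (n ∸ K))
  meet = cong w (sym (mirror 1 K≤n))

  junction-source : w K + reflected (n ∸ K) + 1ℚ ≡ 3ℚ * w (suc K)
  junction-source = subst (λ m → w K + w m + 1ℚ ≡ 3ℚ * w (suc K)) (sym (mirror 2 K≤n)) source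

  reflected-junction-source : reflected (n ∸ K) + w K + 1ℚ ≡ 3ℚ * reflected (suc (n ∸ K))
  reflected-junction-source =
    trans (cong (_+ 1ℚ) (ℚₚ.+-comm _ (w K))) (trans junction-source (cong (3ℚ *_) meet))

  left-decay : ∀ p → suc p ℕ.≤ K → 0< w (suc p) ≤½ w (suc (suc p))
  left-decay = positive-growth left (junction left right meet junction-source)

  right-decay : ∀ p → K ℕ.≤ p → suc p ℕ.≤ n → 0< w (suc (suc p)) ≤½ w (suc p)
  right-decay p K≤p p<n =
    subst₂ 0<_≤½_ (cong w (mirror 1 p<n)) (cong w (ℕₚ.m∸[m∸n]≡n p<n))
      (positive-growth right (junction right left (sym meet) reflected-junction-source)
                       (n ∸ suc p) (ℕₚ.∸-monoʳ-< (ℕ.s≤s K≤p) p<n))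

I-diagonal : ∀ {n} (i : Fin n) → I i i ≡ 1ℚ
I-diagonal i =
  cong (λ b → if b then 1ℚ else 0ℚ) (trans (isYes≗does (i ≟ i)) (dec-true (i ≟ i) refl))

I-off-diagonal : ∀ {n} {i j : Fin n} → i ≢ j → I i j ≡ 0ℚ
I-off-diagonal {i = i} {j} i≢j =
  cong (λ b → if b then 1ℚ else 0ℚ) (trans (isYes≗does (i ≟ j)) (dec-false (i ≟ j) i≢j))

row-isGreenFunction : ∀ {n} (B : Matrix (suc n)) → IsInverseOf B (pathL (suc n) +ᴹ I) →
                      ∀ i → IsGreenFunction (padded (B i)) n (toℕ i)
row-isGreenFunction {n} B inv i = record
  { K≤n            = Finₚ.toℕ≤pred[n] i
  ; left-boundary  = refl
  ; right-boundary = cong (B i) (clamp-suc-n n)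
  ; homogeneous    = homogeneous
  ; source         = trans (cong (neighbours i +_) (sym (I-diagonal i))) (row-equation i)
  }
  where
  w = padded (B i)

  neighbours : Fin (suc n) → ℚ
  neighbours j = w (toℕ j) + w (suc (suc (toℕ j)))

  row-equation : ∀ j → neighbours j + I i j ≡ 3ℚ * w (suc (toℕ j))
  row-equation j = trans (cong (neighbours j +_) (sym (proj₂ inv i j))) (padded-column (B i) j)

  homogeneous : ∀ q → q ℕ.≤ n → q ≢ toℕ i → SolvesAt w q
  homogeneous q q≤n q≢i = subst (SolvesAt w) (Finₚ.toℕ-fromℕ< q<1+n) (begin
    neighbours j         ≡⟨ sym (ℚₚ.+-identityʳ _) ⟩
    neighbours j + 0ℚ    ≡⟨ cong (neighbours j +_) (sym (I-off-diagonal i≢j)) ⟩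
    neighbours j + I i j ≡⟨ row-equation j ⟩
    3ℚ * w (suc (toℕ j)) ∎)
    where
    open ≡-Reasoning
    q<1+n = ℕ.s≤s q≤n
    j = fromℕ< q<1+n
    i≢j : i ≢ j
    i≢j i≡j = q≢i (trans (sym (Finₚ.toℕ-fromℕ< q<1+n)) (cong toℕ (sym i≡j)))

module _ {n} (B : Matrix (suc n)) (inv : IsInverseOf B (pathL (suc n) +ᴹ I)) (i j k : Fin (suc n))
         (k≡1+j : toℕ k ≡ suc (toℕ j)) where
  open GreenFunction (row-isGreenFunction B inv i)

  padded-next : padded (B i) (suc (suc (toℕ j))) ≡ B i k
  padded-next = trans (cong (padded (B i) ∘ suc) (sym k≡1+j)) (padded-at (B i) k)

  row-left : toℕ k ℕ.≤ toℕ i → 0< B i j ≤½ B i k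
  row-left k≤i = subst₂ 0<_≤½_ (padded-at (B i) j) padded-next
    (left-decay (toℕ j) (subst (ℕ._≤ toℕ i) k≡1+j k≤i))

  row-right : toℕ i ℕ.≤ toℕ j → 0< B i k ≤½ B i j
  row-right i≤j = subst₂ 0<_≤½_ padded-next (padded-at (B i) j)
    (right-decay (toℕ j) i≤j (subst (ℕ._≤ n) k≡1+j (Finₚ.toℕ≤pred[n] k)))

theorem2p3 : (n : ℕ) (B : Matrix n) → IsInverseOf B (pathL n +ᴹ I) →
    ((∀ i j k → toℕ k ≡ suc (toℕ j) → toℕ k ℕ.≤ toℕ i → B i j < B i k)
    × (∀ i j k → toℕ k ≡ suc (toℕ j) → toℕ i ℕ.≤ toℕ j → B i k < B i j))
    × ((∀ i j k → toℕ k ≡ suc (toℕ j) → toℕ i ℕ.≤ toℕ j → (1ℚ + 1ℚ) * B i k ≤ B i j)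
    × (∀ i j k → toℕ k ≡ suc (toℕ j) → toℕ k ℕ.≤ toℕ i → (1ℚ + 1ℚ) * B i j ≤ B i k))
theorem2p3 zero    B _   = ((λ ()) , (λ ())) , ((λ ()) , (λ ()))
theorem2p3 (suc n) B inv =
  ( (λ i j k k≡1+j k≤i → <-of-≤½ (row-left B inv i j k k≡1+j k≤i))
  , (λ i j k k≡1+j i≤j → <-of-≤½ (row-right B inv i j k k≡1+j i≤j)) )
  , ( (λ i j k k≡1+j i≤j → proj₂ (row-right B inv i j k k≡1+j i≤j))
    , (λ i j k k≡1+j k≤i → proj₂ (row-left B inv i j k k≡1+j k≤i)) )
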